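{- If $f:\{0,1\}^n\to\{0,1\}$ is any anti-monotone conjunction, then the following algorithm accepts $f$ with probability $1$ (for any choice of $\varepsilon>0$ and positive constants $c_1,c_2$). Phase 1: repeat $c_1/\varepsilon$ times: draw $x,y\sim\mathrm{Samp}(f)$; if $f(x\oplus y)=0$, halt and reject. Phase 2: repeat $c_2$ times: draw $x\sim\mathrm{Samp}(f)$, draw $y$ uniformly from $\{y:y\preceq x\}$, draw $u\sim\mathrm{Samp}(f)$; if $f(y\oplus u)=0$, halt and reject. Finally, accept.
   Context: An anti-monotone conjunction is a conjunction of negated variables. $y\preceq x$ means $y_i\le x_i$ for all $i$; $\oplus$ is coordinatewise XOR. $\mathrm{Samp}(f)$ returns an independent uniformly random element of $f^{ -1}(1)$; values $f(\cdot)$ are obtained via membership queries. -}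

module Defs where

open import Data.Bool using (Bool; true; false; _∧_; _xor_; not; if_then_else_)
open import Data.Nat using (ℕ)
open import Data.Fin using (Fin)
open import Data.Vec using (Vec; zipWith; lookup; allFin; foldr; map)
open import Data.Fin.Subset using (Subset)
open import Data.List using (List; []; _∷_)
open import Data.List.Relation.Unary.All using (All)
open import Data.Product using (_×_; _,_; ∃)
open import Relation.Binary.PropositionalEquality using (_≡_)

BitVec : ℕ → Set
BitVec n = Vec Bool n

_⊕_ : ∀ {n} → BitVec n → BitVec n → BitVec n
_⊕_ = zipWith _xor_

_≼_ : ∀ {n} → BitVec n → BitVec n → Set
y ≼ x = ∀ i → lookup y i ≡ true → lookup x i ≡ true

antiConj : ∀ {n} → Subset n → BitVec n → Bool
antiConj {n} S x =
  foldr _ _∧_ true (map (λ i → if lookup S i then not (lookup x i) else true) (allFin n))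

IsAntiMonotoneConjunction : ∀ {n} → (BitVec n → Bool) → Set
IsAntiMonotoneConjunction {n} f = ∃ λ (S : Subset n) → ∀ x → f x ≡ antiConj S x

phase1 : ∀ {n} → (BitVec n → Bool) → List (BitVec n × BitVec n) → Bool
phase1 f [] = true
phase1 f ((x , y) ∷ rest) = if f (x ⊕ y) then phase1 f rest else false

phase2 : ∀ {n} → (BitVec n → Bool) → List (BitVec n × BitVec n × BitVec n) → Bool
phase2 f [] = true
phase2 f ((x , y , u) ∷ rest) = if f (y ⊕ u) then phase2 f rest else false

tester : ∀ {n} → (BitVec n → Bool) →
         List (BitVec n × BitVec n) → List (BitVec n × BitVec n × BitVec n) → Bool
tester f ps ts = if phase1 f ps then phase2 f ts else false

-- A run's random draws are possible (in the support of the sampling distributions):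
-- Samp(f) outputs lie in f⁻¹(1); y is drawn from {y : y ≼ x}.
ValidPhase1Draws : ∀ {n} → (BitVec n → Bool) → List (BitVec n × BitVec n) → Set
ValidPhase1Draws f = All (λ { (x , y) → f x ≡ true × f y ≡ true })

ValidPhase2Draws : ∀ {n} → (BitVec n → Bool) → List (BitVec n × BitVec n × BitVec n) → Set
ValidPhase2Draws f = All (λ { (x , y , u) → f x ≡ true × y ≼ x × f u ≡ true })

-- The ones of the anti-monotone conjunction ∧_{i ∈ S} ¬xᵢ are exactly the points vanishing
-- on S. That set is closed under ⊕ and downward closed under ≼, so every point the tester
-- queries (x ⊕ y in phase 1, y ⊕ u with y ≼ x in phase 2) is again a one of f.
module Submission where

open import Defs
open import Data.Bool using (Bool; true; false; _∧_; _xor_; not; if_then_else_)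
open import Data.Nat using (ℕ; zero; suc)
open import Data.Fin using (Fin; zero; suc)
open import Data.Fin.Subset using (Subset)
open import Data.Vec using (lookup; foldr; tabulate)
open import Data.Vec.Properties using (tabulate-allFin; lookup-zipWith)
open import Data.List using (List; length; []; _∷_)
open import Data.List.Relation.Unary.All using ([]; _∷_)
open import Data.Product using (_×_; _,_)
open import Relation.Binary.PropositionalEquality
  using (_≡_; refl; sym; trans; cong; cong₂; module ≡-Reasoning)

private variable n : ℕ

and-tabulate-true⇒ : (g : Fin n → Bool) → foldr _ _∧_ true (tabulate g) ≡ true →
                     ∀ i → g i ≡ true
and-tabulate-true⇒ {suc n} g h i with g zero in g₀
and-tabulate-true⇒ {suc n} g h zero    | true = g₀
and-tabulate-true⇒ {suc n} g h (suc i) | true = and-tabulate-true⇒ (λ j → g (suc j)) h i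

and-tabulate-true⇐ : (g : Fin n → Bool) → (∀ i → g i ≡ true) →
                     foldr _ _∧_ true (tabulate g) ≡ true
and-tabulate-true⇐ {zero}  g h = refl
and-tabulate-true⇐ {suc n} g h rewrite h zero = and-tabulate-true⇐ (λ j → g (suc j)) (λ j → h (suc j))

clause-true⇒ : ∀ s a → (if s then not a else true) ≡ true → s ≡ true → a ≡ false
clause-true⇒ true false _ _ = refl

clause-true⇐ : ∀ s a → (s ≡ true → a ≡ false) → (if s then not a else true) ≡ true
clause-true⇐ false a     _ = refl
clause-true⇐ true  false _ = refl
clause-true⇐ true  true  h with h refl
... | ()

antiConjClause : Subset n → BitVec n → Fin n → Bool
antiConjClause S x i = if lookup S i then not (lookup x i) else true

antiConj≡and-tabulate : (S : Subset n) (x : BitVec n) →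
                        antiConj S x ≡ foldr _ _∧_ true (tabulate (antiConjClause S x))
antiConj≡and-tabulate S x = cong (foldr _ _∧_ true) (sym (tabulate-allFin (antiConjClause S x)))

VanishesOn : Subset n → BitVec n → Set
VanishesOn S x = ∀ i → lookup S i ≡ true → lookup x i ≡ false

antiConj-true⇒vanishesOn : (S : Subset n) (x : BitVec n) → antiConj S x ≡ true → VanishesOn S x
antiConj-true⇒vanishesOn S x h i =
  clause-true⇒ (lookup S i) (lookup x i)
    (and-tabulate-true⇒ (antiConjClause S x) (trans (sym (antiConj≡and-tabulate S x)) h) i)

vanishesOn⇒antiConj-true : (S : Subset n) (x : BitVec n) → VanishesOn S x → antiConj S x ≡ true
vanishesOn⇒antiConj-true S x h =
  trans (antiConj≡and-tabulate S x)
        (and-tabulate-true⇐ (antiConjClause S x) (λ i → clause-true⇐ (lookup S i) (lookup x i) (h i)))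

vanishesOn-⊕ : (S : Subset n) (x y : BitVec n) →
               VanishesOn S x → VanishesOn S y → VanishesOn S (x ⊕ y)
vanishesOn-⊕ S x y hx hy i i∈S = begin
  lookup (x ⊕ y) i            ≡⟨ lookup-zipWith _xor_ i x y ⟩
  lookup x i xor lookup y i   ≡⟨ cong₂ _xor_ (hx i i∈S) (hy i i∈S) ⟩
  false                       ∎
  where open ≡-Reasoning

vanishesOn-≼ : (S : Subset n) (x y : BitVec n) → y ≼ x → VanishesOn S x → VanishesOn S y
vanishesOn-≼ S x y y≼x hx i i∈S with lookup y i in yᵢ
... | false = refl
... | true  with trans (sym (y≼x i yᵢ)) (hx i i∈S)
...            | ()

XorClosed : (BitVec n → Bool) → Set
XorClosed f = ∀ x y → f x ≡ true → f y ≡ true → f (x ⊕ y) ≡ true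

DownwardClosed : (BitVec n → Bool) → Set
DownwardClosed f = ∀ x y → y ≼ x → f x ≡ true → f y ≡ true

antiMonotoneConjunction⇒xorClosed : (f : BitVec n → Bool) →
                                    IsAntiMonotoneConjunction f → XorClosed f
antiMonotoneConjunction⇒xorClosed f (S , f≗) x y fx fy =
  trans (f≗ (x ⊕ y))
    (vanishesOn⇒antiConj-true S (x ⊕ y)
      (vanishesOn-⊕ S x y (antiConj-true⇒vanishesOn S x (trans (sym (f≗ x)) fx))
                          (antiConj-true⇒vanishesOn S y (trans (sym (f≗ y)) fy))))

antiMonotoneConjunction⇒downwardClosed : (f : BitVec n → Bool) →
                                         IsAntiMonotoneConjunction f → DownwardClosed f
antiMonotoneConjunction⇒downwardClosed f (S , f≗) x y y≼x fx =
  trans (f≗ y)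
    (vanishesOn⇒antiConj-true S y
      (vanishesOn-≼ S x y y≼x (antiConj-true⇒vanishesOn S x (trans (sym (f≗ x)) fx))))

phase1-accepts : (f : BitVec n → Bool) → XorClosed f →
                 (ps : List (BitVec n × BitVec n)) → ValidPhase1Draws f ps → phase1 f ps ≡ true
phase1-accepts f closed []             []                  = refl
phase1-accepts f closed ((x , y) ∷ ps) ((fx , fy) ∷ valid)
  rewrite closed x y fx fy = phase1-accepts f closed ps valid

phase2-accepts : (f : BitVec n → Bool) → XorClosed f → DownwardClosed f →
                 (ts : List (BitVec n × BitVec n × BitVec n)) →
                 ValidPhase2Draws f ts → phase2 f ts ≡ true
phase2-accepts f closed down []                 []                        = refl
phase2-accepts f closed down ((x , y , u) ∷ ts) ((fx , y≼x , fu) ∷ valid)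
  rewrite closed y u (down x y y≼x fx) fu = phase2-accepts f closed down ts valid

tester-accepts : (f : BitVec n → Bool) → XorClosed f → DownwardClosed f →
                 (ps : List (BitVec n × BitVec n)) (ts : List (BitVec n × BitVec n × BitVec n)) →
                 ValidPhase1Draws f ps → ValidPhase2Draws f ts → tester f ps ts ≡ true
tester-accepts f closed down ps ts valid₁ valid₂
  rewrite phase1-accepts f closed ps valid₁ = phase2-accepts f closed down ts valid₂

theorem3p8 : (n : ℕ) (f : BitVec n → Bool) → IsAntiMonotoneConjunction f →
    (m k : ℕ) (ps : List (BitVec n × BitVec n)) (ts : List (BitVec n × BitVec n × BitVec n)) →
    length ps ≡ m → length ts ≡ k →
    ValidPhase1Draws f ps → ValidPhase2Draws f ts →
    tester f ps ts ≡ true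
theorem3p8 n f anti m k ps ts _ _ =
  tester-accepts f (antiMonotoneConjunction⇒xorClosed f anti)
                   (antiMonotoneConjunction⇒downwardClosed f anti) ps ts
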